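{- Let $m$ be a positive integer, $r$ a nonnegative integer, $\lambda\in\mathbb{R}$. For $n,k\in\mathbb{N}$ with $n\ge k$, $$V_{m,\lambda}^{(r)}(n+1,k)=V_{m,\lambda}^{(r)}(n,k-1)+(k\lambda-r-mn)V_{m,\lambda}^{(r)}(n,k).$$
   Context: $(x)_{0,\lambda}=1$, $(x)_{n,\lambda}=x(x-\lambda)\cdots(x-(n-1)\lambda)$, $(x)_n=(x)_{n,1}$. The degenerate $r$-Whitney numbers of the first kind are defined by the polynomial identities $m^n(x)_n=\sum_{k=0}^n V_{m,\lambda}^{(r)}(n,k)(mx+r)_{k,\lambda}$, $n\ge0$, with the convention $V_{m,\lambda}^{(r)}(n,k)=0$ if $k<0$ or $k>n$. -}

module Defs where

open import Level using (_⊔_)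
open import Algebra.Bundles using (CommutativeRing)
open import Data.Nat using (ℕ; zero; suc; _<_; _^_)
open import Data.Product using (_×_)
open import Data.Sum using (_⊎_)
open import Data.Empty using (⊥)

module _ {c ℓ} (R : CommutativeRing c ℓ) where
  open CommutativeRing R hiding (zero)

  ι : ℕ → Carrier
  ι zero = 0#
  ι (suc n) = 1# + ι n

  CharZero : Set ℓ
  CharZero = ∀ n → ι (suc n) ≈ 0# → ⊥

  NoZeroDivisors : Set (c ⊔ ℓ)
  NoZeroDivisors = ∀ a b → a * b ≈ 0# → (a ≈ 0#) ⊎ (b ≈ 0#)

  fall : Carrier → Carrier → ℕ → Carrier
  fall y lam zero = 1#
  fall y lam (suc k) = fall y lam k * (y - ι k * lam)

  sumTo : (ℕ → Carrier) → ℕ → Carrier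
  sumTo f zero = f zero
  sumTo f (suc n) = sumTo f n + f (suc n)

  -- V is the family of degenerate r-Whitney numbers of the first kind V^{(r)}_{m,λ}(n,k)
  -- (for 0 ≤ k), i.e. it satisfies the defining identities
  --   m^n (x)_n = Σ_{k=0}^n V(n,k) (m x + r)_{k,λ}   for all n and all x,
  -- together with the convention V(n,k) = 0 for k > n.
  IsDegWhitney1 : ℕ → ℕ → Carrier → (ℕ → ℕ → Carrier) → Set (c ⊔ ℓ)
  IsDegWhitney1 m r lam V =
    (∀ n x → ι (m ^ n) * fall x 1# n ≈ sumTo (λ k → V n k * fall (ι m * x + ι r) lam k) n)
    × (∀ n k → n < k → V n k ≈ 0#)

  -- V(n, k-1), using the convention V(n,-1) = 0
  Vprev : (ℕ → ℕ → Carrier) → ℕ → ℕ → Carrier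
  Vprev V n zero = 0#
  Vprev V n (suc k) = V n k

-- Write h_k(x) = (m x + r)_{k,λ}. By the Leibniz rule for a factor of degree one,
-- the k-th forward difference of h_k is the constant k! m^k and the (k+1)-st vanishes;
-- in a domain of characteristic zero k! m^k ≠ 0, so the h_k are linearly independent
-- as functions of x and coefficients of an expansion in them are unique. Now
-- m^{n+1} (x)_{n+1} = m^n (x)_n (m x - m n), and h_k(x) (m x - m n) = h_{k+1}(x) + (kλ - r - m n) h_k(x),
-- so both sides of the recurrence are coefficients of the same function.
module Submission where

open import Algebra.Bundles using (CommutativeRing)
import Algebra.Properties.AbelianGroup as AbelianGroupProperties
import Algebra.Properties.CommutativeSemigroup as CommutativeSemigroupProperties
import Algebra.Properties.Group as GroupProperties
import Algebra.Properties.Ring as RingProperties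
import Algebra.Properties.Semiring.Mult as SemiringMult
import Algebra.Solver.Ring
open import Algebra.Solver.Ring.AlmostCommutativeRing
  using (fromCommutativeRing; _-Raw-AlmostCommutative⟶_)
open import Data.Empty using (⊥; ⊥-elim)
open import Data.Integer.Base as ℤ using (ℤ; +_; -[1+_])
import Data.Integer.Properties as ℤ
open import Data.Maybe.Base as Maybe using (Maybe)
open import Data.Nat.Base as ℕ using (ℕ; zero; suc; _≤_; _^_; z≤n)
import Data.Nat.Properties as ℕ
open import Data.Product.Base using (_,_)
open import Data.Sign.Base as Sign using (Sign)
open import Data.Sum.Base using (inj₁; inj₂)
import Relation.Binary.PropositionalEquality.Core as P
import Relation.Binary.Reasoning.Setoid as SetoidReasoning
open import Relation.Nullary.Decidable.Core using (dec⇒maybe)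

open import Defs

module _ {c ℓ} (R : CommutativeRing c ℓ) where
  open CommutativeRing R hiding (zero)
  open RingProperties ring using (-1*x≈-x; [y-z]x≈yx-zx)
  open GroupProperties +-group using (ε⁻¹≈ε; ⁻¹-involutive; x∙y⁻¹≈ε⇒x≈y; x≈y⇒x∙y⁻¹≈ε; ∙-cancelʳ)
  open AbelianGroupProperties +-abelianGroup using (⁻¹-∙-comm)
  open CommutativeSemigroupProperties *-commutativeSemigroup using () renaming (interchange to *-interchange)
  open CommutativeSemigroupProperties +-commutativeSemigroup using () renaming (interchange to +-interchange)
  open SemiringMult semiring using (_×_; ×-homo-+; ×1-homo-*)
  open SetoidReasoning setoid

  ι≈×1# : ∀ n → ι R n ≈ n × 1#
  ι≈×1# zero = refl
  ι≈×1# (suc n) = +-congˡ (ι≈×1# n)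

  ι-+ : ∀ a b → ι R (a ℕ.+ b) ≈ ι R a + ι R b
  ι-+ a b = trans (ι≈×1# (a ℕ.+ b))
    (trans (×-homo-+ 1# a b) (sym (+-cong (ι≈×1# a) (ι≈×1# b))))

  ι-* : ∀ a b → ι R (a ℕ.* b) ≈ ι R a * ι R b
  ι-* a b = trans (ι≈×1# (a ℕ.* b))
    (trans (×1-homo-* a b) (sym (*-cong (ι≈×1# a) (ι≈×1# b))))

  fromSign : Sign → Carrier
  fromSign Sign.+ = 1#
  fromSign Sign.- = - 1#

  fromℤ : ℤ → Carrier
  fromℤ (+ n) = ι R n
  fromℤ -[1+ n ] = - ι R (suc n)

  fromSign-* : ∀ s t → fromSign (s Sign.* t) ≈ fromSign s * fromSign t
  fromSign-* Sign.+ t = sym (*-identityˡ _)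
  fromSign-* Sign.- Sign.+ = sym (*-identityʳ _)
  fromSign-* Sign.- Sign.- = sym (trans (-1*x≈-x _) (⁻¹-involutive _))

  fromℤ-◃ : ∀ s n → fromℤ (s ℤ.◃ n) ≈ fromSign s * ι R n
  fromℤ-◃ s zero = sym (zeroʳ _)
  fromℤ-◃ Sign.+ (suc n) = sym (*-identityˡ _)
  fromℤ-◃ Sign.- (suc n) = sym (-1*x≈-x _)

  fromℤ-signAbs : ∀ i → fromℤ i ≈ fromSign (ℤ.sign i) * ι R ℤ.∣ i ∣
  fromℤ-signAbs (+ n) = sym (*-identityˡ _)
  fromℤ-signAbs -[1+ n ] = sym (-1*x≈-x _)

  [z+x]-[z+y]≈x-y : ∀ x y z → (z + x) - (z + y) ≈ x - y
  [z+x]-[z+y]≈x-y x y z = begin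
    (z + x) - (z + y)     ≈⟨ +-congˡ (⁻¹-∙-comm z y) ⟨
    (z + x) + (- z - y)   ≈⟨ +-interchange z x (- z) (- y) ⟩
    (z - z) + (x - y)     ≈⟨ +-congʳ (-‿inverseʳ z) ⟩
    0# + (x - y)          ≈⟨ +-identityˡ _ ⟩
    x - y                 ∎

  fromℤ-⊖ : ∀ a b → fromℤ (a ℤ.⊖ b) ≈ ι R a - ι R b
  fromℤ-⊖ zero zero = sym (-‿inverseʳ 0#)
  fromℤ-⊖ zero (suc b) = sym (+-identityˡ _)
  fromℤ-⊖ (suc a) zero = sym (trans (+-congˡ ε⁻¹≈ε) (+-identityʳ _))
  fromℤ-⊖ (suc a) (suc b) = begin
    fromℤ (suc a ℤ.⊖ suc b)           ≡⟨ P.cong fromℤ (ℤ.[1+m]⊖[1+n]≡m⊖n a b) ⟩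
    fromℤ (a ℤ.⊖ b)                   ≈⟨ fromℤ-⊖ a b ⟩
    ι R a - ι R b                     ≈⟨ [z+x]-[z+y]≈x-y (ι R a) (ι R b) 1# ⟨
    ι R (suc a) - ι R (suc b)         ∎

  fromℤ-+ : ∀ i j → fromℤ (i ℤ.+ j) ≈ fromℤ i + fromℤ j
  fromℤ-+ -[1+ m ] -[1+ n ] = begin
    - ι R (suc (suc (m ℕ.+ n)))       ≡⟨ P.cong (λ k → - ι R (suc k)) (ℕ.+-suc m n) ⟨
    - ι R (suc m ℕ.+ suc n)           ≈⟨ -‿cong (ι-+ (suc m) (suc n)) ⟩
    - (ι R (suc m) + ι R (suc n))     ≈⟨ ⁻¹-∙-comm _ _ ⟨
    - ι R (suc m) - ι R (suc n)       ∎
  fromℤ-+ -[1+ m ] (+ n) = trans (fromℤ-⊖ n (suc m)) (+-comm _ _)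
  fromℤ-+ (+ m) -[1+ n ] = fromℤ-⊖ m (suc n)
  fromℤ-+ (+ m) (+ n) = ι-+ m n

  fromℤ-* : ∀ i j → fromℤ (i ℤ.* j) ≈ fromℤ i * fromℤ j
  fromℤ-* i j = begin
    fromℤ ((ℤ.sign i Sign.* ℤ.sign j) ℤ.◃ (ℤ.∣ i ∣ ℕ.* ℤ.∣ j ∣))
      ≈⟨ fromℤ-◃ (ℤ.sign i Sign.* ℤ.sign j) (ℤ.∣ i ∣ ℕ.* ℤ.∣ j ∣) ⟩
    fromSign (ℤ.sign i Sign.* ℤ.sign j) * ι R (ℤ.∣ i ∣ ℕ.* ℤ.∣ j ∣)
      ≈⟨ *-cong (fromSign-* (ℤ.sign i) (ℤ.sign j)) (ι-* ℤ.∣ i ∣ ℤ.∣ j ∣) ⟩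
    (fromSign (ℤ.sign i) * fromSign (ℤ.sign j)) * (ι R ℤ.∣ i ∣ * ι R ℤ.∣ j ∣)
      ≈⟨ *-interchange _ _ _ _ ⟩
    (fromSign (ℤ.sign i) * ι R ℤ.∣ i ∣) * (fromSign (ℤ.sign j) * ι R ℤ.∣ j ∣)
      ≈⟨ *-cong (fromℤ-signAbs i) (fromℤ-signAbs j) ⟨
    fromℤ i * fromℤ j ∎

  fromℤ-neg : ∀ i → fromℤ (ℤ.- i) ≈ - fromℤ i
  fromℤ-neg -[1+ n ] = sym (⁻¹-involutive _)
  fromℤ-neg (+ zero) = sym ε⁻¹≈ε
  fromℤ-neg (+ suc n) = refl

  fromℤ-homomorphism : ℤ.+-*-rawRing -Raw-AlmostCommutative⟶ fromCommutativeRing R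
  fromℤ-homomorphism = record
    { ⟦_⟧ = fromℤ
    ; +-homo = fromℤ-+
    ; *-homo = fromℤ-*
    ; -‿homo = fromℤ-neg
    ; 0-homo = refl
    ; 1-homo = +-identityʳ 1#
    }

  fromℤ-≟ : ∀ i j → Maybe (fromℤ i ≈ fromℤ j)
  fromℤ-≟ i j = Maybe.map (λ i≡j → reflexive (P.cong fromℤ i≡j)) (dec⇒maybe (i ℤ.≟ j))

  open Algebra.Solver.Ring ℤ.+-*-rawRing (fromCommutativeRing R) fromℤ-homomorphism fromℤ-≟
    using (solve; _:=_; _:+_; _:*_; _:-_; con)

  Δ : (Carrier → Carrier) → Carrier → Carrier
  Δ f x = f (x + 1#) - f x

  Δ^ : ℕ → (Carrier → Carrier) → Carrier → Carrier
  Δ^ zero f = f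
  Δ^ (suc n) f = Δ (Δ^ n f)

  Δ^-cong : ∀ {f g} → (∀ x → f x ≈ g x) → ∀ n x → Δ^ n f x ≈ Δ^ n g x
  Δ^-cong f≈g zero x = f≈g x
  Δ^-cong f≈g (suc n) x = +-cong (Δ^-cong f≈g n (x + 1#)) (-‿cong (Δ^-cong f≈g n x))

  Δ-const : ∀ {f} k → (∀ x → f x ≈ k) → ∀ x → Δ f x ≈ 0#
  Δ-const k f≈k x = trans (+-cong (f≈k (x + 1#)) (-‿cong (f≈k x))) (-‿inverseʳ k)

  Δ^-+ : ∀ n f g x → Δ^ n (λ y → f y + g y) x ≈ Δ^ n f x + Δ^ n g x
  Δ^-+ zero f g x = refl
  Δ^-+ (suc n) f g x = trans (+-cong (Δ^-+ n f g (x + 1#)) (-‿cong (Δ^-+ n f g x)))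
    (solve 4 (λ f₁ g₁ f₀ g₀ → (f₁ :+ g₁) :- (f₀ :+ g₀) := (f₁ :- f₀) :+ (g₁ :- g₀)) refl
      (Δ^ n f (x + 1#)) (Δ^ n g (x + 1#)) (Δ^ n f x) (Δ^ n g x))

  Δ^-*ˡ : ∀ n k f x → Δ^ n (λ y → k * f y) x ≈ k * Δ^ n f x
  Δ^-*ˡ zero k f x = refl
  Δ^-*ˡ (suc n) k f x = trans (+-cong (Δ^-*ˡ n k f (x + 1#)) (-‿cong (Δ^-*ˡ n k f x)))
    (solve 3 (λ k f₁ f₀ → k :* f₁ :- k :* f₀ := k :* (f₁ :- f₀)) refl
      k (Δ^ n f (x + 1#)) (Δ^ n f x))

  -- The 1# of x + 1# enters the solver as the variable o, since fromℤ (+ 1) is 1# + 0#, not 1#.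
  Δ^-*-affine : ∀ n f a b x →
    Δ^ (suc n) (λ y → f y * (a * y + b)) x
      ≈ Δ^ (suc n) f x * (a * x + b) + ι R (suc n) * a * Δ^ n f (x + 1#)
  Δ^-*-affine zero f a b x =
    solve 6 (λ f₁ f₀ a b x o →
        f₁ :* (a :* (x :+ o) :+ b) :- f₀ :* (a :* x :+ b)
          := (f₁ :- f₀) :* (a :* x :+ b) :+ (o :+ con (+ 0)) :* a :* f₁)
      refl (f (x + 1#)) (f x) a b x 1#
  Δ^-*-affine (suc n) f a b x =
    trans (+-cong (Δ^-*-affine n f a b (x + 1#)) (-‿cong (Δ^-*-affine n f a b x)))
      (solve 8 (λ f₂ f₁ f₀ k a b x o →
          (f₂ :- f₁) :* (a :* (x :+ o) :+ b) :+ k :* a :* f₂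
            :- ((f₁ :- f₀) :* (a :* x :+ b) :+ k :* a :* f₁)
          := ((f₂ :- f₁) :- (f₁ :- f₀)) :* (a :* x :+ b) :+ (o :+ k) :* a :* (f₂ :- f₁))
        refl (Δ^ n f ((x + 1#) + 1#)) (Δ^ n f (x + 1#)) (Δ^ n f x) (ι R (suc n)) a b x 1#)

  sumTo-cong : ∀ {f g} → (∀ j → f j ≈ g j) → ∀ N → sumTo R f N ≈ sumTo R g N
  sumTo-cong f≈g zero = f≈g zero
  sumTo-cong f≈g (suc N) = +-cong (sumTo-cong f≈g N) (f≈g (suc N))

  sumTo-+ : ∀ f g N → sumTo R (λ j → f j + g j) N ≈ sumTo R f N + sumTo R g N
  sumTo-+ f g zero = refl
  sumTo-+ f g (suc N) = trans (+-congʳ (sumTo-+ f g N)) (+-interchange _ _ _ _)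

  sumTo-*ʳ : ∀ f k N → sumTo R (λ j → f j * k) N ≈ sumTo R f N * k
  sumTo-*ʳ f k zero = refl
  sumTo-*ʳ f k (suc N) = trans (+-congʳ (sumTo-*ʳ f k N)) (sym (distribʳ k _ _))

  sumTo-suc : ∀ f N → sumTo R f (suc N) ≈ f 0 + sumTo R (λ j → f (suc j)) N
  sumTo-suc f zero = refl
  sumTo-suc f (suc N) = trans (+-congʳ (sumTo-suc f N)) (+-assoc _ _ _)

  *-cancelʳ-nonZero : NoZeroDivisors R → ∀ {x y z} → (z ≈ 0# → ⊥) → x * z ≈ y * z → x ≈ y
  *-cancelʳ-nonZero noZeroDivisors {x} {y} {z} z≉0 xz≈yz
    with noZeroDivisors (x - y) z (trans ([y-z]x≈yx-zx z x y) (x≈y⇒x∙y⁻¹≈ε xz≈yz))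
  ... | inj₁ x-y≈0 = x∙y⁻¹≈ε⇒x≈y x y x-y≈0
  ... | inj₂ z≈0 = ⊥-elim (z≉0 z≈0)

  module _ (a b lam : Carrier) where

    basis : ℕ → Carrier → Carrier
    basis k x = fall R (a * x + b) lam k

    combination : ℕ → (ℕ → Carrier) → Carrier → Carrier
    combination N u x = sumTo R (λ k → u k * basis k x) N

    leading : ℕ → Carrier
    leading zero = 1#
    leading (suc k) = ι R (suc k) * a * leading k

    basis-suc : ∀ k x → basis (suc k) x ≈ basis k x * (a * x + (b - ι R k * lam))
    basis-suc k x = *-congˡ (+-assoc _ _ _)

    Δ^-basis : ∀ k x → Δ^ k (basis k) x ≈ leading k
    Δ^-basis zero x = refl
    Δ^-basis (suc k) x = begin
      Δ^ (suc k) (basis (suc k)) x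
        ≈⟨ Δ^-cong (basis-suc k) (suc k) x ⟩
      Δ^ (suc k) (λ y → basis k y * (a * y + c′)) x
        ≈⟨ Δ^-*-affine k (basis k) a c′ x ⟩
      Δ^ (suc k) (basis k) x * (a * x + c′) + ι R (suc k) * a * Δ^ k (basis k) (x + 1#)
        ≈⟨ +-cong (*-congʳ (Δ-const (leading k) (Δ^-basis k) x)) (*-congˡ (Δ^-basis k (x + 1#))) ⟩
      0# * (a * x + c′) + leading (suc k)
        ≈⟨ trans (+-congʳ (zeroˡ _)) (+-identityˡ _) ⟩
      leading (suc k) ∎
      where c′ = b - ι R k * lam

    Δ^-combination : ∀ N u x → Δ^ N (combination N u) x ≈ u N * leading N
    Δ^-combination zero u x = refl
    Δ^-combination (suc N) u x = begin
      Δ^ (suc N) (λ y → combination N u y + top y) x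
        ≈⟨ Δ^-+ (suc N) (combination N u) top x ⟩
      Δ^ (suc N) (combination N u) x + Δ^ (suc N) top x
        ≈⟨ +-cong (Δ-const (u N * leading N) (Δ^-combination N u) x)
                  (Δ^-*ˡ (suc N) (u (suc N)) (basis (suc N)) x) ⟩
      0# + u (suc N) * Δ^ (suc N) (basis (suc N)) x
        ≈⟨ trans (+-identityˡ _) (*-congˡ (Δ^-basis (suc N) x)) ⟩
      u (suc N) * leading (suc N) ∎
      where
      top : Carrier → Carrier
      top y = u (suc N) * basis (suc N) y

    module _ (charZero : CharZero R) (noZeroDivisors : NoZeroDivisors R) (a≉0 : a ≈ 0# → ⊥) where

      leading-nonZero : ∀ k → leading k ≈ 0# → ⊥
      leading-nonZero zero 1≈0 = charZero 0 (trans (+-identityʳ 1#) 1≈0)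
      leading-nonZero (suc k) eq with noZeroDivisors _ _ eq
      ... | inj₂ leading≈0 = leading-nonZero k leading≈0
      ... | inj₁ ka≈0 with noZeroDivisors _ _ ka≈0
      ...   | inj₁ k≈0 = charZero k k≈0
      ...   | inj₂ a≈0 = a≉0 a≈0

      combination-top : ∀ N u v → (∀ x → combination N u x ≈ combination N v x) → u N ≈ v N
      combination-top N u v u≗v = *-cancelʳ-nonZero noZeroDivisors (leading-nonZero N) (begin
        u N * leading N            ≈⟨ Δ^-combination N u 0# ⟨
        Δ^ N (combination N u) 0#  ≈⟨ Δ^-cong u≗v N 0# ⟩
        Δ^ N (combination N v) 0#  ≈⟨ Δ^-combination N v 0# ⟩
        v N * leading N            ∎)

      combination-injective : ∀ N u v → (∀ x → combination N u x ≈ combination N v x) →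
                              ∀ k → k ≤ N → u k ≈ v k
      combination-injective zero u v u≗v zero z≤n = combination-top zero u v u≗v
      combination-injective (suc N) u v u≗v k k≤1+N with ℕ.m≤n⇒m<n∨m≡n k≤1+N
      ... | inj₂ P.refl = combination-top (suc N) u v u≗v
      ... | inj₁ k<1+N = combination-injective N u v lower k (ℕ.s≤s⁻¹ k<1+N)
        where
        lower : ∀ x → combination N u x ≈ combination N v x
        lower x = ∙-cancelʳ (v (suc N) * basis (suc N) x) _ _
          (trans (+-congˡ (*-congʳ (sym (combination-top (suc N) u v u≗v)))) (u≗v x))

    basis-*-affine : ∀ t k x →
      basis k x * (a * x - t) ≈ basis (suc k) x + (ι R k * lam - b - t) * basis k x
    basis-*-affine t k x = trans
      (solve 6 (λ h a x t b kl → h :* (a :* x :- t) := h :* (a :* x :+ (b :- kl)) :+ (kl :- b :- t) :* h)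
         refl (basis k x) a x t b (ι R k * lam))
      (+-congʳ (sym (basis-suc k x)))

    combination-*-affine : ∀ (V : ℕ → ℕ → Carrier) n t x → V n (suc n) ≈ 0# →
      combination (suc n) (λ k → Vprev R V n k + (ι R k * lam - b - t) * V n k) x
        ≈ combination n (V n) x * (a * x - t)
    combination-*-affine V n t x V[n,1+n]≈0 = begin
      sumTo R (λ k → (Vprev R V n k + e k * V n k) * basis k x) (suc n)
        ≈⟨ trans (sumTo-cong (λ k → distribʳ (basis k x) _ _) (suc n)) (sumTo-+ _ _ (suc n)) ⟩
      sumTo R (λ k → Vprev R V n k * basis k x) (suc n) + sumTo R (λ k → e k * V n k * basis k x) (suc n)
        ≈⟨ +-cong shifted truncated ⟩
      sumTo R (λ k → V n k * basis (suc k) x) n + sumTo R (λ k → e k * V n k * basis k x) n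
        ≈⟨ sumTo-+ _ _ n ⟨
      sumTo R (λ k → V n k * basis (suc k) x + e k * V n k * basis k x) n
        ≈⟨ sumTo-cong termwise n ⟩
      sumTo R (λ k → V n k * basis k x * (a * x - t)) n
        ≈⟨ sumTo-*ʳ _ _ n ⟩
      combination n (V n) x * (a * x - t) ∎
      where
      e : ℕ → Carrier
      e k = ι R k * lam - b - t

      shifted : sumTo R (λ k → Vprev R V n k * basis k x) (suc n)
              ≈ sumTo R (λ k → V n k * basis (suc k) x) n
      shifted = trans (sumTo-suc _ n) (trans (+-congʳ (zeroˡ _)) (+-identityˡ _))

      truncated : sumTo R (λ k → e k * V n k * basis k x) (suc n)
                ≈ sumTo R (λ k → e k * V n k * basis k x) n
      truncated = trans (+-congˡ (trans (*-congʳ (trans (*-congˡ V[n,1+n]≈0) (zeroʳ _))) (zeroˡ _)))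
                        (+-identityʳ _)

      termwise : ∀ k → V n k * basis (suc k) x + e k * V n k * basis k x
                     ≈ V n k * basis k x * (a * x - t)
      termwise k = begin
        V n k * basis (suc k) x + e k * V n k * basis k x
          ≈⟨ solve 4 (λ v h₁ e h₀ → v :* h₁ :+ e :* v :* h₀ := v :* (h₁ :+ e :* h₀)) refl
               (V n k) (basis (suc k) x) (e k) (basis k x) ⟩
        V n k * (basis (suc k) x + e k * basis k x)  ≈⟨ *-congˡ (basis-*-affine t k x) ⟨
        V n k * (basis k x * (a * x - t))            ≈⟨ *-assoc _ _ _ ⟨
        V n k * basis k x * (a * x - t)              ∎

  ι-nonZero : CharZero R → ∀ {m} → 1 ≤ m → ι R m ≈ 0# → ⊥
  ι-nonZero charZero {suc m} _ = charZero m

  whitney-expansion-suc : ∀ m r lam (V : ℕ → ℕ → Carrier) → IsDegWhitney1 R m r lam V → ∀ n x →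
    combination (ι R m) (ι R r) lam (suc n) (V (suc n)) x
      ≈ combination (ι R m) (ι R r) lam n (V n) x * (ι R m * x - ι R m * ι R n)
  whitney-expansion-suc m r lam V (expansion , _) n x = begin
    combination (ι R m) (ι R r) lam (suc n) (V (suc n)) x
      ≈⟨ expansion (suc n) x ⟨
    ι R (m ℕ.* m ^ n) * (fall R x 1# n * (x - ι R n * 1#))
      ≈⟨ *-cong (ι-* m (m ^ n)) (*-congˡ (+-congˡ (-‿cong (*-identityʳ _)))) ⟩
    ι R m * ι R (m ^ n) * (fall R x 1# n * (x - ι R n))
      ≈⟨ solve 5 (λ m mⁿ F x n → m :* mⁿ :* (F :* (x :- n)) := mⁿ :* F :* (m :* x :- m :* n)) refl
           (ι R m) (ι R (m ^ n)) (fall R x 1# n) x (ι R n) ⟩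
    ι R (m ^ n) * fall R x 1# n * (ι R m * x - ι R m * ι R n)
      ≈⟨ *-congʳ (expansion n x) ⟩
    combination (ι R m) (ι R r) lam n (V n) x * (ι R m * x - ι R m * ι R n) ∎

theorem6 : ∀ {c ℓ} (R : CommutativeRing c ℓ) →
    CharZero R → NoZeroDivisors R →
    (m : ℕ) → 1 ≤ m → (r : ℕ) → (lam : CommutativeRing.Carrier R) →
    (V : ℕ → ℕ → CommutativeRing.Carrier R) → IsDegWhitney1 R m r lam V →
    ∀ n k → k ≤ n →
    let open CommutativeRing R in
    V (suc n) k ≈ Vprev R V n k + (ι R k * lam - ι R r - ι R m * ι R n) * V n k
theorem6 R charZero noZeroDivisors m 1≤m r lam V whitney@(_ , vanishing) n k k≤n =
  combination-injective R (ι R m) (ι R r) lam charZero noZeroDivisors (ι-nonZero R charZero 1≤m)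
    (suc n) (V (suc n)) _ same k (ℕ.m≤n⇒m≤1+n k≤n)
  where
  open CommutativeRing R
  same : ∀ x → combination R (ι R m) (ι R r) lam (suc n) (V (suc n)) x
             ≈ combination R (ι R m) (ι R r) lam (suc n)
                 (λ j → Vprev R V n j + (ι R j * lam - ι R r - ι R m * ι R n) * V n j) x
  same x = trans (whitney-expansion-suc R m r lam V whitney n x)
    (sym (combination-*-affine R (ι R m) (ι R r) lam V n (ι R m * ι R n) x
           (vanishing n (suc n) (ℕ.n<1+n n))))
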